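{- For every $t\in\mathbb{N}$ there exist a graph $G_t$ and a circular drawing $D$ of $G_t$ such that $G_t$ contains a $K_t$-minor, $G_t$ has maximum degree $3$, and the crossing graph $X_D$ is $2$-degenerate.
   Context: A circular drawing of a graph $G$ places the vertices at distinct points on a circle and draws each edge as the straight line segment between its endpoints. Two edges cross if their segments intersect at a point that is not an endpoint of either. The crossing graph $X_D$ has vertex set $E(G)$, two edges adjacent iff they cross in $D$. A graph is $2$-degenerate if every nonempty subgraph has a vertex of degree at most $2$. -}

module Defs where

open import Data.Nat using (ℕ; _≤_; _<ᵇ_; _≡ᵇ_)
open import Data.Fin using (Fin; toℕ)
open import Data.Bool using (Bool; true; false; _∧_; _∨_; _xor_; not)
open import Data.Maybe using (Maybe; just)
open import Data.Product using (_×_; _,_; ∃; ∃₂)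
open import Data.List using (List; length; filterᵇ; allFin; cartesianProduct)
open import Data.List.Relation.Unary.Any using (Any)
open import Function.Definitions using (Injective)
open import Relation.Binary.PropositionalEquality using (_≡_; _≢_)

record SimpleGraph (n : ℕ) : Set where
  field
    adj        : Fin n → Fin n → Bool
    adj-sym    : ∀ u v → adj u v ≡ adj v u
    adj-irrefl : ∀ v → adj v v ≡ false
open SimpleGraph public

degree : ∀ {n} → SimpleGraph n → Fin n → ℕ
degree {n} G v = length (filterᵇ (adj G v) (allFin n))

MaxDegree : ∀ {n} → SimpleGraph n → ℕ → Set
MaxDegree G d = (∀ v → degree G v ≤ d) × ∃ λ v → degree G v ≡ d

data PathIn {n} (G : SimpleGraph n) (P : Fin n → Set) : Fin n → Fin n → Set where
  here : ∀ {v} → P v → PathIn G P v v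
  step : ∀ {u w v} → P u → adj G u w ≡ true → PathIn G P w v → PathIn G P u v

-- A K_t-minor model: t pairwise disjoint, nonempty, connected branch sets,
-- pairwise joined by an edge. Branch set i = { v | branch v ≡ just i }.
record KMinor {n} (G : SimpleGraph n) (t : ℕ) : Set where
  field
    branch    : Fin n → Maybe (Fin t)
    nonempty  : ∀ i → ∃ λ v → branch v ≡ just i
    connected : ∀ i u v → branch u ≡ just i → branch v ≡ just i →
                PathIn G (λ w → branch w ≡ just i) u v
    joined    : ∀ i j → i ≢ j →
                ∃₂ λ u v → branch u ≡ just i × branch v ≡ just j × adj G u v ≡ true

isEdgeᵇ : ∀ {n} → SimpleGraph n → Fin n × Fin n → Bool
isEdgeᵇ G (u , v) = (toℕ u <ᵇ toℕ v) ∧ adj G u v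

edges : ∀ {n} → SimpleGraph n → List (Fin n × Fin n)
edges {n} G = filterᵇ (isEdgeᵇ G) (cartesianProduct (allFin n) (allFin n))

-- A circular drawing: distinct positions of the vertices along the circle
-- (read in cyclic order starting from an arbitrary point).
record CircularDrawing (n : ℕ) : Set where
  field
    pos     : Fin n → ℕ
    pos-inj : Injective _≡_ _≡_ pos
open CircularDrawing public

-- Two chords ab, cd of a circle cross (in an interior point) iff their four
-- endpoints are distinct and exactly one of c, d lies strictly between a and b.
crossᵇ : ∀ {n} → CircularDrawing n → Fin n × Fin n → Fin n × Fin n → Bool
crossᵇ D (a , b) (c , d) = distinct ∧ (btw c xor btw d)
  where
    p = pos D
    btw : _ → Bool
    btw x = ((p a <ᵇ p x) ∧ (p x <ᵇ p b)) ∨ ((p b <ᵇ p x) ∧ (p x <ᵇ p a))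
    distinct = not (p a ≡ᵇ p c) ∧ not (p a ≡ᵇ p d) ∧ not (p b ≡ᵇ p c) ∧ not (p b ≡ᵇ p d)

-- k-degeneracy of a graph given by a duplicate-free vertex list V and a
-- Boolean adjacency: every nonempty vertex subset S (of V) contains a vertex
-- with at most k neighbours in S.
Degenerate : ∀ {A : Set} → ℕ → List A → (A → A → Bool) → Set
Degenerate {A} k V adjX =
  (S : A → Bool) → Any (λ x → S x ≡ true) V →
  Any (λ x → S x ≡ true × length (filterᵇ (λ y → S y ∧ adjX x y) V) ≤ k) V

CrossingGraph2Degenerate : ∀ {n} → (G : SimpleGraph n) → CircularDrawing n → Set
CrossingGraph2Degenerate G D = Degenerate 2 (edges G) (crossᵇ D)

{-# OPTIONS --safe #-}
module Submission where

-- The graph is built in levels. Level m has vertices 0, …, 2·3^m − 1 in circular order, the spine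
-- path 0 — 1 — 2 — ⋯, and pairwise disjoint chords, so all degrees are at most 3. Level m+1 puts the
-- old vertex w at position embed w, subdividing each spine edge 2i — 2i+1 into 6i, 6i+1, …, 6i+5, and
-- adds the inner chords 6i+1 — 6i+4 and the bridge chords 6i+3 — 6i+8. The vertices 6i+2, 6i+3 form a
-- new branch set: it is connected through the bridge chords, and adjacent to every old branch set
-- through 6i+1 and 6i+4. Hence t+1 levels carry a K_t minor.
-- For 2-degeneracy, rank spine edges 0 and a chord one more than its lower endpoint, where new
-- vertices have rank 0 or 1 and old ones gain 2 per level. Then every edge crosses at most two edges
-- of at least its rank: spine edges cross nothing, an inner chord crosses only the chords at 6i+2 and
-- 6i+3, a bridge chord crosses only inner chords and the chords at 6i+5 and 6i+6, and a chord between
-- old vertices is crossed by higher chords only if they are old, which cross as before. So the edge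
-- of least rank in any set of edges crosses at most two others of the set.

open import Defs
open import Algebra.Properties.CommutativeSemigroup using (x∙yz≈y∙xz)
open import Data.Bool using (Bool; true; false; T; T?; _∧_; _∨_; _xor_; not; if_then_else_)
open import Data.Bool.Properties using (T-≡; ∨-comm)
open import Data.Empty using (⊥-elim)
open import Data.Fin using (Fin; toℕ; fromℕ<; inject≤; #_)
open import Data.Fin.Properties using (toℕ-fromℕ<; toℕ-injective; toℕ<n; toℕ-inject≤; inject≤-injective)
  renaming (_≟_ to _≟ᶠ_)
open import Data.List using (List; []; _∷_; length; filter; filterᵇ; allFin; cartesianProduct)
open import Data.List.Extrema.Nat using (argmin; argmin-all; f[argmin]≤f[xs])
open import Data.List.Membership.Propositional using (_∈_; find)
open import Data.List.Membership.Propositional.Properties using (∈-filter⁺; ∈-filter⁻; ∈-allFin)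
open import Data.List.Properties using (filter-notAll)
open import Data.List.Relation.Unary.All using ([]; _∷_)
import Data.List.Relation.Unary.All as All
open import Data.List.Relation.Unary.Any using (Any; here; there)
import Data.List.Relation.Unary.Any as Any
open import Data.List.Relation.Unary.Unique.Propositional using (Unique; []; _∷_)
import Data.List.Relation.Unary.Unique.Propositional.Properties as Unique
open import Data.Maybe using (Maybe; just; nothing; map; maybe; fromMaybe)
open import Data.Maybe.Properties using (just-injective)
open import Data.Nat using (ℕ; zero; suc; pred; _+_; _*_; _∸_; _^_; _⊓_; _≤_; _<_; z≤n; s≤s; _<ᵇ_; _≡ᵇ_; _≤?_; _<?_)
open import Data.Nat.Properties
open import Data.Product using (Σ; ∃; ∃₂; _×_; _,_; proj₁; proj₂)
open import Data.Sum using (_⊎_; inj₁; inj₂)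
import Data.Sum as Sum
open import Function using (id; _∘_)
open import Function.Bundles using (Equivalence)
open import Relation.Binary.Construct.Closure.ReflexiveTransitive using (Star; ε; _◅_; _◅◅_; reverse; kleisliStar)
open import Relation.Binary.Definitions using (DecidableEquality; tri<; tri≈; tri>)
open import Relation.Binary.PropositionalEquality
open import Relation.Nullary using (¬_; ¬?; yes; no)
open import Relation.Nullary.Decidable using (True; toWitness)

≡true⇒T : ∀ {p} → p ≡ true → T p
≡true⇒T = Equivalence.from T-≡

T-injective : ∀ {p q} → (T p → T q) → (T q → T p) → p ≡ q
T-injective {false} {false} _ _ = refl
T-injective {false} {true}  _ g = ⊥-elim (g _)
T-injective {true}  {false} f _ = ⊥-elim (f _)
T-injective {true}  {true}  _ _ = refl

∧-≡-true : ∀ {a b} → a ∧ b ≡ true → a ≡ true × b ≡ true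
∧-≡-true {true} {true} refl = refl , refl

≡ᵇ-refl : ∀ a → (a ≡ᵇ a) ≡ true
≡ᵇ-refl a = Equivalence.to T-≡ (≡⇒≡ᵇ a a refl)

≡ᵇ-≢ : ∀ {a b} → a ≢ b → (a ≡ᵇ b) ≡ false
≡ᵇ-≢ {a} {b} a≢b with a ≡ᵇ b in eq
... | true  = ⊥-elim (a≢b (≡ᵇ⇒≡ a b (≡true⇒T eq)))
... | false = refl

module _ {A B : Set} (_≟_ : DecidableEquality B) (f : A → B) where

  length-≤-by-injection : ∀ {xs : List A} {ys : List B} → Unique xs →
    (∀ {x y} → x ∈ xs → y ∈ xs → f x ≡ f y → x ≡ y) → (∀ {x} → x ∈ xs → f x ∈ ys) →
    length xs ≤ length ys
  length-≤-by-injection {[]} _ _ _ = z≤n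
  length-≤-by-injection {x ∷ xs} {ys} (x∉xs ∷ xs!) inj into =
    ≤-trans (s≤s (length-≤-by-injection xs! (λ y∈ z∈ → inj (there y∈) (there z∈)) into′))
            (filter-notAll (λ y → ¬? (f x ≟ y)) ys (Any.map (λ fx≡y fx≢y → fx≢y fx≡y) (into (here refl))))
    where
      into′ : ∀ {y} → y ∈ xs → f y ∈ filter (λ y → ¬? (f x ≟ y)) ys
      into′ y∈ = ∈-filter⁺ (λ y → ¬? (f x ≟ y)) (into (there y∈))
                   (λ fx≡fy → All.lookup x∉xs y∈ (inj (here refl) (there y∈) fx≡fy))

module _ {A : Set} (P : A → Bool) where

  ∈-filterᵇ⁻ : ∀ {x xs} → x ∈ filterᵇ P xs → x ∈ xs × P x ≡ true
  ∈-filterᵇ⁻ x∈ with ∈-filter⁻ (T? ∘ P) x∈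
  ... | x∈xs , Px = x∈xs , Equivalence.to T-≡ Px

  ∈-filterᵇ⁺ : ∀ {x xs} → x ∈ xs → P x ≡ true → x ∈ filterᵇ P xs
  ∈-filterᵇ⁺ x∈ Px = ∈-filter⁺ (T? ∘ P) x∈ (Equivalence.from T-≡ Px)

  Unique-filterᵇ : ∀ {xs} → Unique xs → Unique (filterᵇ P xs)
  Unique-filterᵇ = Unique.filter⁺ (T? ∘ P)

  ∃-minimal : (rank : A → ℕ) (xs : List A) → Any (λ x → P x ≡ true) xs →
    ∃ λ m → m ∈ xs × P m ≡ true × (∀ {y} → y ∈ xs → P y ≡ true → rank m ≤ rank y)
  ∃-minimal rank xs any with find any
  ... | x , x∈xs , Px = m , proj₁ m∈ , proj₂ m∈ , minimal
    where
      candidates = filterᵇ P xs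
      m = argmin rank x candidates
      m∈ : m ∈ xs × P m ≡ true
      m∈ = argmin-all rank (x∈xs , Px) (All.tabulate ∈-filterᵇ⁻)
      minimal : ∀ {y} → y ∈ xs → P y ≡ true → rank m ≤ rank y
      minimal y∈ Py = All.lookup (f[argmin]≤f[xs] x candidates) (∈-filterᵇ⁺ y∈ Py)

module _ {A : Set} (V : List A) (adj : A → A → Bool) (rank : A → ℕ) where

  LaterNeighbour : A → A → Set
  LaterNeighbour x y = y ∈ V × adj x y ≡ true × rank x ≤ rank y

  FewLaterNeighbours : (key : A → ℕ) → ℕ → A → Set
  FewLaterNeighbours key k x = Σ (List ℕ) λ ks → length ks ≤ k ×
    (∀ {y} → LaterNeighbour x y → key y ∈ ks) ×
    (∀ {y z} → LaterNeighbour x y → LaterNeighbour x z → key y ≡ key z → y ≡ z)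

  degenerate-byRank : ∀ key k → Unique V → (∀ {x} → x ∈ V → FewLaterNeighbours key k x) → Degenerate k V adj
  degenerate-byRank key k V! few S nonempty with ∃-minimal S rank V nonempty
  ... | x , x∈V , Sx , minimal with few x∈V
  ... | ks , |ks|≤k , into , inj = Any.map (λ { refl → Sx , count }) x∈V
    where
      later : ∀ {y} → y ∈ filterᵇ (λ y → S y ∧ adj x y) V → LaterNeighbour x y
      later y∈ with ∈-filterᵇ⁻ (λ y → S y ∧ adj x y) y∈
      ... | y∈V , Sy∧xy = y∈V , proj₂ (∧-≡-true Sy∧xy) , minimal y∈V (proj₁ (∧-≡-true Sy∧xy))
      count : length (filterᵇ (λ y → S y ∧ adj x y) V) ≤ k
      count = ≤-trans (length-≤-by-injection _≟_ key (Unique-filterᵇ (λ y → S y ∧ adj x y) V!)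
                         (λ y∈ z∈ → inj (later y∈) (later z∈)) (into ∘ later)) |ks|≤k

-- The levels of the construction

-- blocksFrom f i v reads v as offset k < 6 in block i + ⌊v/6⌋ and returns f (i + ⌊v/6⌋) k; the block
-- functions below therefore end with a junk clause for offsets ≥ 6, which is never reached.
module _ {A : Set} (f : ℕ → ℕ → A) where

  blocksFrom : ℕ → ℕ → A
  blocksFrom i (suc (suc (suc (suc (suc (suc v)))))) = blocksFrom (suc i) v
  blocksFrom i k = f i k

  blocksFrom-+* : ∀ j i k → blocksFrom j (k + i * 6) ≡ blocksFrom (j + i) k
  blocksFrom-+* j zero k rewrite +-identityʳ k | +-identityʳ j = refl
  blocksFrom-+* j (suc i) k rewrite x∙yz≈y∙xz +-commutativeSemigroup k 6 (i * 6) | +-suc j i = blocksFrom-+* (suc j) i k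

  blocks : ℕ → A
  blocks = blocksFrom 0

  blocks-+* : ∀ i k → blocks (k + i * 6) ≡ blocksFrom i k
  blocks-+* = blocksFrom-+* 0

data Offset6 : ℕ → Set where
  at0 : ∀ i → Offset6 (0 + i * 6)
  at1 : ∀ i → Offset6 (1 + i * 6)
  at2 : ∀ i → Offset6 (2 + i * 6)
  at3 : ∀ i → Offset6 (3 + i * 6)
  at4 : ∀ i → Offset6 (4 + i * 6)
  at5 : ∀ i → Offset6 (5 + i * 6)

offset6 : ∀ v → Offset6 v
offset6 0 = at0 0
offset6 1 = at1 0
offset6 2 = at2 0
offset6 3 = at3 0
offset6 4 = at4 0
offset6 5 = at5 0
offset6 (suc (suc (suc (suc (suc (suc v)))))) with offset6 v
... | at0 i = at0 (suc i)
... | at1 i = at1 (suc i)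
... | at2 i = at2 (suc i)
... | at3 i = at3 (suc i)
... | at4 i = at4 (suc i)
... | at5 i = at5 (suc i)

data Parity : ℕ → Set where
  even : ∀ i → Parity (i * 2)
  odd  : ∀ i → Parity (1 + i * 2)

parity : ∀ v → Parity v
parity 0 = even 0
parity 1 = odd 0
parity (suc (suc v)) with parity v
... | even i = even (suc i)
... | odd i  = odd (suc i)

embed : ℕ → ℕ
embed 0 = 0
embed 1 = 5
embed (suc (suc w)) = 6 + embed w

embed-even : ∀ i → embed (i * 2) ≡ i * 6
embed-even zero    = refl
embed-even (suc i) = cong (6 +_) (embed-even i)

embed-odd : ∀ i → embed (1 + i * 2) ≡ 5 + i * 6
embed-odd zero    = refl
embed-odd (suc i) = cong (6 +_) (embed-odd i)

embed-<-suc : ∀ w → embed w < embed (suc w)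
embed-<-suc 0 = s≤s z≤n
embed-<-suc 1 = s≤s (s≤s (s≤s (s≤s (s≤s (s≤s z≤n)))))
embed-<-suc (suc (suc w)) = +-monoʳ-< 6 (embed-<-suc w)

embed-< : ∀ {x y} → x < y → embed x < embed y
embed-< {x} {suc y} (s≤s x≤y) with m≤n⇒m<n∨m≡n x≤y
... | inj₁ x<y  = <-trans (embed-< x<y) (embed-<-suc y)
... | inj₂ refl = embed-<-suc x

embed-cancel-< : ∀ {x y} → embed x < embed y → x < y
embed-cancel-< {x} {y} ex<ey with <-cmp x y
... | tri< x<y _ _  = x<y
... | tri≈ _ refl _ = ⊥-elim (<-irrefl refl ex<ey)
... | tri> _ _ y<x  = ⊥-elim (<-asym ex<ey (embed-< y<x))

embed-injective : ∀ {x y} → embed x ≡ embed y → x ≡ y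
embed-injective {x} {y} ex≡ey with <-cmp x y
... | tri< x<y _ _ = ⊥-elim (<-irrefl ex≡ey (embed-< x<y))
... | tri≈ _ x≡y _ = x≡y
... | tri> _ _ y<x = ⊥-elim (<-irrefl (sym ex≡ey) (embed-< y<x))

size : ℕ → ℕ
size m = 3 ^ m * 2

bridgeBack : ℕ → Maybe ℕ
bridgeBack zero    = nothing
bridgeBack (suc i) = just (3 + i * 6)

partnerInBlock : (ℕ → Maybe ℕ) → ℕ → ℕ → Maybe ℕ
partnerInBlock P i 0 = map embed (P (i * 2))
partnerInBlock P i 1 = just (4 + i * 6)
partnerInBlock P i 2 = bridgeBack i
partnerInBlock P i 3 = just (2 + suc i * 6)
partnerInBlock P i 4 = just (1 + i * 6)
partnerInBlock P i 5 = map embed (P (1 + i * 2))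
partnerInBlock P i _ = nothing

partner : ℕ → ℕ → Maybe ℕ
partner zero    = λ _ → nothing
partner (suc m) = blocks (partnerInBlock (partner m))

rankInBlock : (ℕ → ℕ) → ℕ → ℕ → ℕ
rankInBlock R i 0 = 2 + R (i * 2)
rankInBlock R i 1 = 0
rankInBlock R i 2 = 1
rankInBlock R i 3 = 1
rankInBlock R i 4 = 0
rankInBlock R i 5 = 2 + R (1 + i * 2)
rankInBlock R i _ = 0

rank : ℕ → ℕ → ℕ
rank zero    = λ _ → 0
rank (suc m) = blocks (rankInBlock (rank m))

labelInBlock : ℕ → (ℕ → ℕ) → ℕ → ℕ → ℕ
labelInBlock new L i 0 = L (i * 2)
labelInBlock new L i 1 = L (i * 2)
labelInBlock new L i 2 = new
labelInBlock new L i 3 = new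
labelInBlock new L i 4 = L (1 + i * 2)
labelInBlock new L i 5 = L (1 + i * 2)
labelInBlock new L i _ = new

label : ℕ → ℕ → ℕ
label zero    = λ _ → 0
label (suc m) = blocks (labelInBlock (suc m) (label m))

partner-block : ∀ m i k → partner (suc m) (k + i * 6) ≡ blocksFrom (partnerInBlock (partner m)) i k
partner-block m = blocks-+* (partnerInBlock (partner m))

rank-block : ∀ m i k → rank (suc m) (k + i * 6) ≡ blocksFrom (rankInBlock (rank m)) i k
rank-block m = blocks-+* (rankInBlock (rank m))

label-block : ∀ m i k → label (suc m) (k + i * 6) ≡ blocksFrom (labelInBlock (suc m) (label m)) i k
label-block m = blocks-+* (labelInBlock (suc m) (label m))

partner-embed : ∀ m w → partner (suc m) (embed w) ≡ map embed (partner m w)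
partner-embed m w with parity w
... | even i rewrite embed-even i = partner-block m i 0
... | odd i  rewrite embed-odd i  = partner-block m i 5

rank-embed : ∀ m w → rank (suc m) (embed w) ≡ 2 + rank m w
rank-embed m w with parity w
... | even i rewrite embed-even i = rank-block m i 0
... | odd i  rewrite embed-odd i  = rank-block m i 5

label-embed : ∀ m w → label (suc m) (embed w) ≡ label m w
label-embed m w with parity w
... | even i rewrite embed-even i = label-block m i 0
... | odd i  rewrite embed-odd i  = label-block m i 5

data Position : ℕ → Set where
  old     : ∀ w → Position (embed w)
  innerL  : ∀ i → Position (1 + i * 6)
  bridgeL : ∀ i → Position (2 + i * 6)
  bridgeR : ∀ i → Position (3 + i * 6)
  innerR  : ∀ i → Position (4 + i * 6)

position : ∀ v → Position v
position v with offset6 v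
... | at0 i = subst Position (embed-even i) (old (i * 2))
... | at1 i = innerL i
... | at2 i = bridgeL i
... | at3 i = bridgeR i
... | at4 i = innerR i
... | at5 i = subst Position (embed-odd i) (old (1 + i * 2))

map≡just : ∀ {f : ℕ → ℕ} mx {y} → map f mx ≡ just y → ∃ λ x → mx ≡ just x × y ≡ f x
map≡just (just x) refl = x , refl , refl

+-≢ʳ : ∀ {k l} x → k ≢ l → k + x ≢ l + x
+-≢ʳ x k≢l eq = k≢l (+-cancelʳ-≡ x _ _ eq)

partner-sym : ∀ m {a b} → partner m a ≡ just b → partner m b ≡ just a
partner-sym zero ()
partner-sym (suc m) {a} pa with position a
... | old w with map≡just (partner m w) (trans (sym (partner-embed m w)) pa)
...   | b , pw , refl = trans (partner-embed m b) (cong (map embed) (partner-sym m pw))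
partner-sym (suc m) pa | innerL i with just-injective (trans (sym (partner-block m i 1)) pa)
... | refl = partner-block m i 4
partner-sym (suc m) pa | bridgeL (suc i) with just-injective (trans (sym (partner-block m (suc i) 2)) pa)
... | refl = partner-block m i 3
partner-sym (suc m) pa | bridgeR i with just-injective (trans (sym (partner-block m i 3)) pa)
... | refl = partner-block m (suc i) 2
partner-sym (suc m) pa | innerR i with just-injective (trans (sym (partner-block m i 4)) pa)
... | refl = partner-block m i 1

partner-irrefl : ∀ m {a b} → partner m a ≡ just b → a ≢ b
partner-irrefl zero ()
partner-irrefl (suc m) {a} pa with position a
... | old w with map≡just (partner m w) (trans (sym (partner-embed m w)) pa)
...   | b , pw , refl = partner-irrefl m pw ∘ embed-injective
partner-irrefl (suc m) pa | innerL i with just-injective (trans (sym (partner-block m i 1)) pa)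
... | refl = +-≢ʳ (i * 6) λ ()
partner-irrefl (suc m) pa | bridgeL (suc i) with just-injective (trans (sym (partner-block m (suc i) 2)) pa)
... | refl = +-≢ʳ (i * 6) λ ()
partner-irrefl (suc m) pa | bridgeR i with just-injective (trans (sym (partner-block m i 3)) pa)
... | refl = +-≢ʳ (i * 6) λ ()
partner-irrefl (suc m) pa | innerR i with just-injective (trans (sym (partner-block m i 4)) pa)
... | refl = +-≢ʳ (i * 6) λ ()

-- Crossings

betweenᵇ : ℕ → ℕ → ℕ → Bool
betweenᵇ a b x = ((a <ᵇ x) ∧ (x <ᵇ b)) ∨ ((b <ᵇ x) ∧ (x <ᵇ a))

-- crossᵇ D of the drawing with pos = toℕ, computed on positions.
crossesᵇ : ℕ → ℕ → ℕ → ℕ → Bool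
crossesᵇ a b c d =
  (not (a ≡ᵇ c) ∧ not (a ≡ᵇ d) ∧ not (b ≡ᵇ c) ∧ not (b ≡ᵇ d)) ∧ (betweenᵇ a b c xor betweenᵇ a b d)

embed-<ᵇ : ∀ x y → (embed x <ᵇ embed y) ≡ (x <ᵇ y)
embed-<ᵇ x y = T-injective (λ p → <⇒<ᵇ {x} {y} (embed-cancel-< (<ᵇ⇒< (embed x) (embed y) p)))
                          (λ p → <⇒<ᵇ {embed x} {embed y} (embed-< (<ᵇ⇒< x y p)))

embed-≡ᵇ : ∀ x y → (embed x ≡ᵇ embed y) ≡ (x ≡ᵇ y)
embed-≡ᵇ x y = T-injective (λ p → ≡⇒≡ᵇ x y (embed-injective (≡ᵇ⇒≡ (embed x) (embed y) p)))
                          (λ p → ≡⇒≡ᵇ (embed x) (embed y) (cong embed (≡ᵇ⇒≡ x y p)))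

crossesᵇ-embed : ∀ a b c d → crossesᵇ (embed a) (embed b) (embed c) (embed d) ≡ crossesᵇ a b c d
crossesᵇ-embed a b c d
  rewrite embed-≡ᵇ a c | embed-≡ᵇ a d | embed-≡ᵇ b c | embed-≡ᵇ b d
        | embed-<ᵇ a c | embed-<ᵇ c b | embed-<ᵇ b c | embed-<ᵇ c a
        | embed-<ᵇ a d | embed-<ᵇ d b | embed-<ᵇ b d | embed-<ᵇ d a = refl

betweenᵇ⇒< : ∀ {a b} x → betweenᵇ a b x ≡ true → a < b → a < x × x < b
betweenᵇ⇒< {a} {b} x e a<b with a <ᵇ x in a<x | x <ᵇ b in x<b | b <ᵇ x in b<x | x <ᵇ a in x<a
... | true  | true  | _    | _    = <ᵇ⇒< a x (≡true⇒T a<x) , <ᵇ⇒< x b (≡true⇒T x<b)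
... | true  | false | true | true = ⊥-elim (<-asym (<ᵇ⇒< a x (≡true⇒T a<x)) (<ᵇ⇒< x a (≡true⇒T x<a)))
... | false | _     | true | true =
  ⊥-elim (<-asym a<b (<-trans (<ᵇ⇒< b x (≡true⇒T b<x)) (<ᵇ⇒< x a (≡true⇒T x<a))))

crossesᵇ⇒between : ∀ {a b} c d → crossesᵇ a b c d ≡ true → a < b → (a < c × c < b) ⊎ (a < d × d < b)
crossesᵇ⇒between {a} {b} c d cr a<b
  with not (a ≡ᵇ c) ∧ not (a ≡ᵇ d) ∧ not (b ≡ᵇ c) ∧ not (b ≡ᵇ d)
     | betweenᵇ a b c in ac | betweenᵇ a b d in ad
... | true | true  | _    = inj₁ (betweenᵇ⇒< c ac a<b)
... | true | false | true = inj₂ (betweenᵇ⇒< d ad a<b)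

Touches : ℕ → ℕ → ℕ → Set
Touches c d e = c ≡ e ⊎ d ≡ e

-- Chords are pairwise disjoint, so at most two of them meet {e₁, e₂}.
HighCrossersMeetPair : ℕ → ℕ → ℕ → Set
HighCrossersMeetPair m a b = Σ ℕ λ e₁ → Σ ℕ λ e₂ →
  ∀ {c d} → partner m c ≡ just d → c < d → crossesᵇ a b c d ≡ true → rank m a ≤ rank m c →
  Touches c d e₁ ⊎ Touches c d e₂

offset-from : ∀ {j l} x c → j + x < c → c < l + x → ∃ λ k → j < k × k < l × c ≡ k + x
offset-from {j} {l} x c j+x<c c<l+x =
  k , +-cancelʳ-< x j k (subst (j + x <_) (sym k+x≡c) j+x<c)
    , +-cancelʳ-< x k l (subst (_< l + x) (sym k+x≡c) c<l+x) , sym k+x≡c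
  where
    k = c ∸ x
    k+x≡c : k + x ≡ c
    k+x≡c = m∸n+n≡m (≤-trans (m≤n+m x j) (<⇒≤ j+x<c))

rank-high⇒old : ∀ m c → 2 ≤ rank (suc m) c → ∃ λ w → c ≡ embed w
rank-high⇒old m c 2≤r with position c
... | old w = w , refl
... | innerL i with subst (2 ≤_) (rank-block m i 1) 2≤r
...   | ()
rank-high⇒old m c 2≤r | bridgeL i with subst (2 ≤_) (rank-block m i 2) 2≤r
...   | s≤s ()
rank-high⇒old m c 2≤r | bridgeR i with subst (2 ≤_) (rank-block m i 3) 2≤r
...   | s≤s ()
rank-high⇒old m c 2≤r | innerR i with subst (2 ≤_) (rank-block m i 4) 2≤r
...   | ()

touchesInner⇒rank0 : ∀ m i {c d} → partner (suc m) c ≡ just d →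
  Touches c d (1 + i * 6) ⊎ Touches c d (4 + i * 6) → rank (suc m) c ≡ 0
touchesInner⇒rank0 m i pc (inj₁ (inj₁ refl)) = rank-block m i 1
touchesInner⇒rank0 m i {c} pc (inj₁ (inj₂ refl))
  with just-injective {x = c} (trans (sym (partner-sym (suc m) pc)) (partner-block m i 1))
... | refl = rank-block m i 4
touchesInner⇒rank0 m i pc (inj₂ (inj₁ refl)) = rank-block m i 4
touchesInner⇒rank0 m i {c} pc (inj₂ (inj₂ refl))
  with just-injective {x = c} (trans (sym (partner-sym (suc m) pc)) (partner-block m i 4))
... | refl = rank-block m i 1

embedded-highCrossers : ∀ m {w b} → (∀ {a b} → partner m a ≡ just b → a < b → HighCrossersMeetPair m a b) →
  partner m w ≡ just b → w < b → HighCrossersMeetPair (suc m) (embed w) (embed b)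
embedded-highCrossers m {w} {b} ih pw w<b with ih pw w<b
... | e₁ , e₂ , meet = embed e₁ , embed e₂ , meet′
  where
    touches-embed : ∀ {c d e} → Touches c d e → Touches (embed c) (embed d) (embed e)
    touches-embed = Sum.map (cong embed) (cong embed)
    meet′ : ∀ {c d} → partner (suc m) c ≡ just d → c < d → crossesᵇ (embed w) (embed b) c d ≡ true →
            rank (suc m) (embed w) ≤ rank (suc m) c → Touches c d (embed e₁) ⊎ Touches c d (embed e₂)
    meet′ {c} pc c<d cr rk
      with rank-high⇒old m c (≤-trans (m≤m+n 2 _) (subst (_≤ rank (suc m) c) (rank-embed m w) rk))
    ... | c′ , refl with map≡just (partner m c′) (trans (sym (partner-embed m c′)) pc)
    ... | d′ , pc′ , refl =
      Sum.map touches-embed touches-embed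
        (meet pc′ (embed-cancel-< c<d) (trans (sym (crossesᵇ-embed w b c′ d′)) cr)
              (+-cancelˡ-≤ 2 _ _ (subst₂ _≤_ (rank-embed m w) (rank-embed m c′) rk)))

inner-highCrossers : ∀ m i → HighCrossersMeetPair (suc m) (1 + i * 6) (4 + i * 6)
inner-highCrossers m i = 2 + i * 6 , 3 + i * 6 , meet
  where
    strictlyBetween : ∀ {k} → 1 < k → k < 4 → k ≡ 2 ⊎ k ≡ 3
    strictlyBetween {1} (s≤s ()) _
    strictlyBetween {2} _ _ = inj₁ refl
    strictlyBetween {3} _ _ = inj₂ refl
    strictlyBetween {suc (suc (suc (suc _)))} _ (s≤s (s≤s (s≤s (s≤s ()))))
    endpoint : ∀ {y} → ∃ (λ k → 1 < k × k < 4 × y ≡ k + i * 6) → y ≡ 2 + i * 6 ⊎ y ≡ 3 + i * 6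
    endpoint (k , 1<k , k<4 , refl) = Sum.map (cong (_+ i * 6)) (cong (_+ i * 6)) (strictlyBetween 1<k k<4)
    meet : ∀ {c d} → partner (suc m) c ≡ just d → c < d → crossesᵇ (1 + i * 6) (4 + i * 6) c d ≡ true →
           rank (suc m) (1 + i * 6) ≤ rank (suc m) c → Touches c d (2 + i * 6) ⊎ Touches c d (3 + i * 6)
    meet {c} {d} _ _ cr _ with crossesᵇ⇒between c d cr (+-monoˡ-< (i * 6) (s≤s (s≤s z≤n)))
    ... | inj₁ (l , r) = Sum.map inj₁ inj₁ (endpoint (offset-from (i * 6) c l r))
    ... | inj₂ (l , r) = Sum.map inj₂ inj₂ (endpoint (offset-from (i * 6) d l r))

bridge-highCrossers : ∀ m i → HighCrossersMeetPair (suc m) (3 + i * 6) (2 + suc i * 6)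
bridge-highCrossers m i = 5 + i * 6 , 6 + i * 6 , meet
  where
    module _ {c d} (pc : partner (suc m) c ≡ just d) (rk : rank (suc m) (3 + i * 6) ≤ rank (suc m) c) where
      notRank0 : ¬ (rank (suc m) c ≡ 0)
      notRank0 r0 with subst₂ _≤_ (rank-block m i 3) r0 rk
      ... | ()
      endpoint : ∀ {y} → Touches c d y → ∃ (λ k → 3 < k × k < 8 × y ≡ k + i * 6) →
                 Touches c d (5 + i * 6) ⊎ Touches c d (6 + i * 6)
      endpoint t (1 , s≤s () , _)
      endpoint t (2 , s≤s (s≤s ()) , _)
      endpoint t (3 , s≤s (s≤s (s≤s ())) , _)
      endpoint t (4 , _ , _ , refl) = ⊥-elim (notRank0 (touchesInner⇒rank0 m i pc (inj₂ t)))
      endpoint t (5 , _ , _ , refl) = inj₁ t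
      endpoint t (6 , _ , _ , refl) = inj₂ t
      endpoint t (7 , _ , _ , refl) = ⊥-elim (notRank0 (touchesInner⇒rank0 m (suc i) pc (inj₁ t)))
      endpoint t (suc (suc (suc (suc (suc (suc (suc (suc _))))))) , _
                 , s≤s (s≤s (s≤s (s≤s (s≤s (s≤s (s≤s (s≤s ()))))))) , _)
    meet : ∀ {c d} → partner (suc m) c ≡ just d → c < d → crossesᵇ (3 + i * 6) (2 + suc i * 6) c d ≡ true →
           rank (suc m) (3 + i * 6) ≤ rank (suc m) c → Touches c d (5 + i * 6) ⊎ Touches c d (6 + i * 6)
    meet {c} {d} pc _ cr rk with crossesᵇ⇒between c d cr (+-monoˡ-< (i * 6) (s≤s (s≤s (s≤s (s≤s z≤n)))))
    ... | inj₁ (l , r) = endpoint pc rk (inj₁ refl) (offset-from (i * 6) c l r)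
    ... | inj₂ (l , r) = endpoint pc rk (inj₂ refl) (offset-from (i * 6) d l r)

highCrossers : ∀ m {a b} → partner m a ≡ just b → a < b → HighCrossersMeetPair m a b
highCrossers zero ()
highCrossers (suc m) {a} pa a<b with position a
... | old w with map≡just (partner m w) (trans (sym (partner-embed m w)) pa)
...   | b , pw , refl = embedded-highCrossers m (highCrossers m) pw (embed-cancel-< a<b)
highCrossers (suc m) pa a<b | innerL i with just-injective (trans (sym (partner-block m i 1)) pa)
... | refl = inner-highCrossers m i
highCrossers (suc m) pa a<b | bridgeL (suc i) with just-injective (trans (sym (partner-block m (suc i) 2)) pa)
... | refl = ⊥-elim (<⇒≱ a<b (+-monoˡ-≤ (i * 6) (s≤s (s≤s (s≤s z≤n)))))
highCrossers (suc m) pa a<b | bridgeR i with just-injective (trans (sym (partner-block m i 3)) pa)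
... | refl = bridge-highCrossers m i
highCrossers (suc m) pa a<b | innerR i with just-injective (trans (sym (partner-block m i 4)) pa)
... | refl = ⊥-elim (<⇒≱ a<b (+-monoˡ-≤ (i * 6) (s≤s z≤n)))

-- Adjacency and branch sets

_pointsTo_ : Maybe ℕ → ℕ → Bool
nothing pointsTo b = false
just a  pointsTo b = a ≡ᵇ b

linked : ℕ → ℕ → ℕ → Bool
linked m a b = (suc a ≡ᵇ b) ∨ (partner m a pointsTo b)

adjacent : ℕ → ℕ → ℕ → Bool
adjacent m a b = linked m a b ∨ linked m b a

adjacent-sym : ∀ m a b → adjacent m a b ≡ adjacent m b a
adjacent-sym m a b = ∨-comm (linked m a b) (linked m b a)

adjacent-suc : ∀ m a → adjacent m a (suc a) ≡ true
adjacent-suc m a rewrite ≡ᵇ-refl a = refl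

adjacent-suc˘ : ∀ m a → adjacent m (suc a) a ≡ true
adjacent-suc˘ m a = trans (adjacent-sym m (suc a) a) (adjacent-suc m a)

adjacent-partner : ∀ m {a b} → partner m a ≡ just b → adjacent m a b ≡ true
adjacent-partner m {a} {b} pa rewrite pa | ≡ᵇ-refl b with suc a ≡ᵇ b
... | true  = refl
... | false = refl

linked-irrefl : ∀ m a → linked m a a ≡ false
linked-irrefl m a rewrite ≡ᵇ-≢ (1+n≢n {a}) with partner m a in pa
... | nothing = refl
... | just b  = ≡ᵇ-≢ (partner-irrefl m pa ∘ sym)

adjacent-irrefl : ∀ m a → adjacent m a a ≡ false
adjacent-irrefl m a rewrite linked-irrefl m a = refl

data Adjacency (m a b : ℕ) : Set where
  spine  : b ≡ suc a → Adjacency m a b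
  spine˘ : a ≡ suc b → Adjacency m a b
  chord  : partner m a ≡ just b → Adjacency m a b

pointsTo⇒≡just : ∀ mx {b} → mx pointsTo b ≡ true → mx ≡ just b
pointsTo⇒≡just (just a) eq = cong just (≡ᵇ⇒≡ a _ (≡true⇒T eq))

linked⇒ : ∀ m a b → linked m a b ≡ true → b ≡ suc a ⊎ partner m a ≡ just b
linked⇒ m a b l with suc a ≡ᵇ b in e
... | true  = inj₁ (sym (≡ᵇ⇒≡ (suc a) b (≡true⇒T e)))
... | false = inj₂ (pointsTo⇒≡just (partner m a) l)

adjacency : ∀ m {a b} → adjacent m a b ≡ true → Adjacency m a b
adjacency m {a} {b} adj with linked m a b in l
... | true with linked⇒ m a b l
...   | inj₁ b≡1+a = spine b≡1+a
...   | inj₂ pa    = chord pa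
adjacency m {a} {b} adj | false with linked⇒ m b a adj
...   | inj₁ a≡1+b = spine˘ a≡1+b
...   | inj₂ pb    = chord (partner-sym m pb)

size-suc : ∀ m → size (suc m) ≡ 3 ^ m * 6
size-suc m = trans (*-assoc 3 (3 ^ m) 2) (trans (*-comm 3 (3 ^ m * 2)) (*-assoc (3 ^ m) 2 3))

embed-size : ∀ m → embed (size m) ≡ size (suc m)
embed-size m = trans (embed-even (3 ^ m)) (sym (size-suc m))

embed-in-range : ∀ m {w} → w < size m → embed w < size (suc m)
embed-in-range m {w} w< = subst (embed w <_) (embed-size m) (embed-< w<)

embed-in-range⁻¹ : ∀ m {w} → embed w < size (suc m) → w < size m
embed-in-range⁻¹ m {w} ew< = embed-cancel-< (subst (embed w <_) (sym (embed-size m)) ew<)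

pair-in-range : ∀ m {i} → i < 3 ^ m → 1 + i * 2 < size m
pair-in-range m i< = *-monoˡ-≤ 2 i<

pair-in-range⁻¹ : ∀ m {i} → i * 2 < size m → i < 3 ^ m
pair-in-range⁻¹ m {i} lt = *-cancelʳ-< 2 i (3 ^ m) lt

block-in-range : ∀ m i k {k≤5 : True (k ≤? 5)} → 1 + i * 2 < size m → k + i * 6 < size (suc m)
block-in-range m i k {k≤5} lt =
  ≤-<-trans (+-monoˡ-≤ (i * 6) (toWitness k≤5)) (subst (_< size (suc m)) (embed-odd i) (embed-in-range m lt))

block-in-range⁻¹ : ∀ m i k → k + i * 6 < size (suc m) → i < 3 ^ m
block-in-range⁻¹ m i k lt =
  *-cancelʳ-< 6 i (3 ^ m) (≤-<-trans (m≤n+m (i * 6) k) (subst (k + i * 6 <_) (size-suc m) lt))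

label-≤ : ∀ m v → label m v ≤ m
label-≤ zero    v = z≤n
label-≤ (suc m) v with position v
... | old w     = subst (_≤ suc m) (sym (label-embed m w)) (m≤n⇒m≤1+n (label-≤ m w))
... | innerL i  = subst (_≤ suc m) (sym (label-block m i 1)) (m≤n⇒m≤1+n (label-≤ m (i * 2)))
... | bridgeL i = ≤-reflexive (label-block m i 2)
... | bridgeR i = ≤-reflexive (label-block m i 3)
... | innerR i  = subst (_≤ suc m) (sym (label-block m i 4)) (m≤n⇒m≤1+n (label-≤ m (1 + i * 2)))

root : ℕ → ℕ → ℕ
root zero    a = 0
root (suc m) a = if a ≡ᵇ suc m then 2 else embed (root m a)

root-new : ∀ m → root (suc m) (suc m) ≡ 2
root-new m rewrite ≡ᵇ-refl m = refl

root-old : ∀ m {a} → a ≤ m → root (suc m) a ≡ embed (root m a)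
root-old m a≤m rewrite ≡ᵇ-≢ (<⇒≢ (s≤s a≤m)) = refl

record InBranch (m a v : ℕ) : Set where
  constructor inBranch
  field
    in-range : v < size m
    labelled : label m v ≡ a
open InBranch

root-inBranch : ∀ m {a} → a ≤ m → InBranch m a (root m a)
root-inBranch zero    z≤n = inBranch (s≤s z≤n) refl
root-inBranch (suc m) {a} a≤ with a ≟ suc m
... | yes refl rewrite root-new m = inBranch (block-in-range m 0 2 (pair-in-range m (m^n>0 3 m))) refl
... | no a≢ rewrite root-old m (≤-pred (≤∧≢⇒< a≤ a≢)) with root-inBranch m (≤-pred (≤∧≢⇒< a≤ a≢))
...   | inBranch r< lr = inBranch (embed-in-range m r<) (trans (label-embed m (root m a)) lr)

embed-inBranch : ∀ m {a w} → InBranch m a w → InBranch (suc m) a (embed w)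
embed-inBranch m {w = w} (inBranch w< lw) = inBranch (embed-in-range m w<) (trans (label-embed m w) lw)

BranchStep : ℕ → ℕ → ℕ → ℕ → Set
BranchStep m a x y = InBranch m a x × InBranch m a y × adjacent m x y ≡ true

BranchWalk : ℕ → ℕ → ℕ → ℕ → Set
BranchWalk m a = Star (BranchStep m a)

BranchStep-sym : ∀ {m a x y} → BranchStep m a x y → BranchStep m a y x
BranchStep-sym {m} {x = x} {y} (bx , by , x~y) = by , bx , trans (adjacent-sym m y x) x~y

single : ∀ {m a x y} → BranchStep m a x y → BranchWalk m a x y
single s = s ◅ ε

adjacent-embed-odd : ∀ m i → adjacent (suc m) (embed (1 + i * 2)) (embed (2 + i * 2)) ≡ true
adjacent-embed-odd m i =
  subst₂ (λ p q → adjacent (suc m) p q ≡ true) (sym (embed-odd i)) (sym (cong (6 +_) (embed-even i)))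
         (adjacent-suc (suc m) (5 + i * 6))

-- The spine edge 2i — 2i+1 is subdivided at the next level; the inner chord bypasses the new bridge vertices.
consecutive-lift : ∀ m {a x} → InBranch m a x → InBranch m a (suc x) → BranchWalk (suc m) a (embed x) (embed (suc x))
consecutive-lift m {a} {x} bx bx′ with parity x
... | odd i  = single (embed-inBranch m bx , embed-inBranch m bx′ , adjacent-embed-odd m i)
... | even i = subst₂ (BranchWalk (suc m) a) (sym (embed-even i)) (sym (embed-odd i))
                 ((b0 , b1 , adjacent-suc (suc m) (i * 6)) ◅
                  (b1 , b4 , adjacent-partner (suc m) {1 + i * 6} (partner-block m i 1)) ◅
                  (b4 , b5 , adjacent-suc (suc m) (4 + i * 6)) ◅ ε)
  where
    b0 : InBranch (suc m) a (i * 6)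
    b0 = subst (InBranch (suc m) a) (embed-even i) (embed-inBranch m bx)
    b1 : InBranch (suc m) a (1 + i * 6)
    b1 = inBranch (block-in-range m i 1 (in-range bx′)) (trans (label-block m i 1) (labelled bx))
    b4 : InBranch (suc m) a (4 + i * 6)
    b4 = inBranch (block-in-range m i 4 (in-range bx′)) (trans (label-block m i 4) (labelled bx′))
    b5 : InBranch (suc m) a (5 + i * 6)
    b5 = subst (InBranch (suc m) a) (embed-odd i) (embed-inBranch m bx′)

embed-walk : ∀ m {a x y} → BranchWalk m a x y → BranchWalk (suc m) a (embed x) (embed y)
embed-walk m = kleisliStar embed embed-step
  where
    embed-step : ∀ {a x y} → BranchStep m a x y → BranchWalk (suc m) a (embed x) (embed y)
    embed-step {x = x} {y} (bx , by , x~y) with adjacency m {x} {y} x~y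
    ... | spine refl  = consecutive-lift m bx by
    ... | spine˘ refl = reverse BranchStep-sym (consecutive-lift m by bx)
    ... | chord px    = single (embed-inBranch m bx , embed-inBranch m by ,
                                adjacent-partner (suc m) (trans (partner-embed m x) (cong (map embed) px)))

bridge-walk : ∀ m i → i < 3 ^ m → BranchWalk (suc m) (suc m) (2 + i * 6) (root (suc m) (suc m))
bridge-walk m zero    _  rewrite root-new m = ε
bridge-walk m (suc i) i< =
  (b2′ , b3 , adjacent-partner (suc m) {2 + suc i * 6} (partner-block m (suc i) 2)) ◅
  (b3 , b2 , adjacent-suc˘ (suc m) (2 + i * 6)) ◅
  bridge-walk m i i<′
  where
    i<′ = <-trans (n<1+n i) i<
    b2′ : InBranch (suc m) (suc m) (2 + suc i * 6)
    b2′ = inBranch (block-in-range m (suc i) 2 (pair-in-range m i<)) (label-block m (suc i) 2)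
    b3 : InBranch (suc m) (suc m) (3 + i * 6)
    b3 = inBranch (block-in-range m i 3 (pair-in-range m i<′)) (label-block m i 3)
    b2 : InBranch (suc m) (suc m) (2 + i * 6)
    b2 = inBranch (block-in-range m i 2 (pair-in-range m i<′)) (label-block m i 2)

module _ (m : ℕ) (toRoot : ∀ {a v} → InBranch m a v → BranchWalk m a v (root m a)) where

  embedded-walkToRoot : ∀ {a} w → InBranch (suc m) a (embed w) → BranchWalk (suc m) a (embed w) (root (suc m) a)
  embedded-walkToRoot {a} w (inBranch ew< lew) =
    subst (BranchWalk (suc m) a (embed w)) (sym (root-old m a≤m)) (embed-walk m (toRoot bw))
    where
      bw : InBranch m a w
      bw = inBranch (embed-in-range⁻¹ m ew<) (trans (sym (label-embed m w)) lew)
      a≤m : a ≤ m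
      a≤m = subst (_≤ m) (labelled bw) (label-≤ m w)

  blockStart-walkToRoot : ∀ {a} i → InBranch (suc m) a (i * 6) → BranchWalk (suc m) a (i * 6) (root (suc m) a)
  blockStart-walkToRoot {a} i = subst (λ v → InBranch (suc m) a v → BranchWalk (suc m) a v (root (suc m) a))
                                      (embed-even i) (embedded-walkToRoot (i * 2))

  blockEnd-walkToRoot : ∀ {a} i → InBranch (suc m) a (5 + i * 6) → BranchWalk (suc m) a (5 + i * 6) (root (suc m) a)
  blockEnd-walkToRoot {a} i = subst (λ v → InBranch (suc m) a v → BranchWalk (suc m) a v (root (suc m) a))
                                    (embed-odd i) (embedded-walkToRoot (1 + i * 2))

walkToRoot : ∀ m {a v} → InBranch m a v → BranchWalk m a v (root m a)
walkToRoot zero {v = 0} (inBranch _ refl) = ε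
walkToRoot zero {v = 1} (inBranch _ refl) =
  single (inBranch (s≤s (s≤s z≤n)) refl , inBranch (s≤s z≤n) refl , adjacent-suc˘ 0 0)
walkToRoot zero {v = suc (suc _)} (inBranch (s≤s (s≤s ())) _)
walkToRoot (suc m) {a} {v} bv with position v
... | old w = embedded-walkToRoot m (walkToRoot m) w bv
... | innerL i = (bv , b0 , adjacent-suc˘ (suc m) (i * 6)) ◅ blockStart-walkToRoot m (walkToRoot m) i b0
  where
    b0 : InBranch (suc m) a (i * 6)
    b0 = inBranch (<-trans (n<1+n (i * 6)) (in-range bv))
                  (trans (label-block m i 0) (trans (sym (label-block m i 1)) (labelled bv)))
... | innerR i = (bv , b5 , adjacent-suc (suc m) (4 + i * 6)) ◅ blockEnd-walkToRoot m (walkToRoot m) i b5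
  where
    b5 : InBranch (suc m) a (5 + i * 6)
    b5 = inBranch (block-in-range m i 5 (pair-in-range m (block-in-range⁻¹ m i 4 (in-range bv))))
                  (trans (label-block m i 5) (trans (sym (label-block m i 4)) (labelled bv)))
... | bridgeL i with trans (sym (label-block m i 2)) (labelled bv)
...   | refl = bridge-walk m i (block-in-range⁻¹ m i 2 (in-range bv))
walkToRoot (suc m) {a} bv | bridgeR i with trans (sym (label-block m i 3)) (labelled bv)
...   | refl = (bv , b2 , adjacent-suc˘ (suc m) (2 + i * 6)) ◅ bridge-walk m i i<
  where
    i< = block-in-range⁻¹ m i 3 (in-range bv)
    b2 : InBranch (suc m) (suc m) (2 + i * 6)
    b2 = inBranch (block-in-range m i 2 (pair-in-range m i<)) (label-block m i 2)

LabelsAdjacent : ℕ → ℕ → ℕ → Set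
LabelsAdjacent m a b = ∃₂ λ u v → InBranch m a u × InBranch m b v × adjacent m u v ≡ true

LabelsAdjacent-sym : ∀ {m a b} → LabelsAdjacent m a b → LabelsAdjacent m b a
LabelsAdjacent-sym {m} (u , v , bu , bv , adj) = v , u , bv , bu , trans (adjacent-sym m v u) adj

consecutive-link : ∀ m {a b x} → InBranch m a x → InBranch m b (suc x) → LabelsAdjacent (suc m) a b
consecutive-link m {x = x} bx bx′ with parity x
... | odd i  = _ , _ , embed-inBranch m bx , embed-inBranch m bx′ , adjacent-embed-odd m i
... | even i = 1 + i * 6 , 4 + i * 6
             , inBranch (block-in-range m i 1 (in-range bx′)) (trans (label-block m i 1) (labelled bx))
             , inBranch (block-in-range m i 4 (in-range bx′)) (trans (label-block m i 4) (labelled bx′))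
             , adjacent-partner (suc m) {1 + i * 6} (partner-block m i 1)

embed-labelsAdjacent : ∀ m {a b} → LabelsAdjacent m a b → LabelsAdjacent (suc m) a b
embed-labelsAdjacent m (u , v , bu , bv , adj) with adjacency m {u} {v} adj
... | spine refl  = consecutive-link m bu bv
... | spine˘ refl = LabelsAdjacent-sym (consecutive-link m bv bu)
... | chord pu    = embed u , embed v , embed-inBranch m bu , embed-inBranch m bv
                  , adjacent-partner (suc m) (trans (partner-embed m u) (cong (map embed) pu))

newLabel-adjacent : ∀ m {b w} → InBranch m b w → LabelsAdjacent (suc m) b (suc m)
newLabel-adjacent m {w = w} bw with parity w
... | even i = 1 + i * 6 , 2 + i * 6
             , inBranch (block-in-range m i 1 (pair-in-range m i<)) (trans (label-block m i 1) (labelled bw))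
             , inBranch (block-in-range m i 2 (pair-in-range m i<)) (label-block m i 2)
             , adjacent-suc (suc m) (1 + i * 6)
  where i< = pair-in-range⁻¹ m {i} (in-range bw)
... | odd i  = 4 + i * 6 , 3 + i * 6
             , inBranch (block-in-range m i 4 (in-range bw)) (trans (label-block m i 4) (labelled bw))
             , inBranch (block-in-range m i 3 (in-range bw)) (label-block m i 3)
             , adjacent-suc˘ (suc m) (3 + i * 6)

labelsAdjacent : ∀ m {a b} → a ≤ m → b ≤ m → a ≢ b → LabelsAdjacent m a b
labelsAdjacent zero    z≤n z≤n 0≢0 = ⊥-elim (0≢0 refl)
labelsAdjacent (suc m) {a} {b} a≤ b≤ a≢b with a ≟ suc m | b ≟ suc m
... | yes refl | yes refl = ⊥-elim (a≢b refl)
... | yes refl | no b≢    = LabelsAdjacent-sym (newLabel-adjacent m (root-inBranch m (≤-pred (≤∧≢⇒< b≤ b≢))))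
... | no a≢    | yes refl = newLabel-adjacent m (root-inBranch m (≤-pred (≤∧≢⇒< a≤ a≢)))
... | no a≢    | no b≢    =
  embed-labelsAdjacent m (labelsAdjacent m (≤-pred (≤∧≢⇒< a≤ a≢)) (≤-pred (≤∧≢⇒< b≤ b≢)) a≢b)

-- The graph

module Construction (t : ℕ) where

  -- One level more than t labels need, so that degree 3 occurs even for t = 0.
  depth : ℕ
  depth = suc t

  n : ℕ
  n = size depth

  G : SimpleGraph n
  G = record
    { adj        = λ u v → adjacent depth (toℕ u) (toℕ v)
    ; adj-sym    = λ u v → adjacent-sym depth (toℕ u) (toℕ v)
    ; adj-irrefl = λ v → adjacent-irrefl depth (toℕ v)
    }

  D : CircularDrawing n
  D = record { pos = toℕ ; pos-inj = toℕ-injective }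

  branch : Fin n → Maybe (Fin t)
  branch w with label depth (toℕ w) <? t
  ... | yes l<t = just (fromℕ< l<t)
  ... | no _    = nothing

  branch≡just⇒ : ∀ w {i} → branch w ≡ just i → label depth (toℕ w) ≡ toℕ i
  branch≡just⇒ w eq with label depth (toℕ w) <? t
  branch≡just⇒ w refl | yes l<t = sym (toℕ-fromℕ< l<t)

  branch≡just⇐ : ∀ w {i} → label depth (toℕ w) ≡ toℕ i → branch w ≡ just i
  branch≡just⇐ w {i} eq with label depth (toℕ w) <? t
  ... | yes l<t = cong just (toℕ-injective (trans (toℕ-fromℕ< l<t) eq))
  ... | no l≮t  = ⊥-elim (l≮t (subst (_< t) (sym eq) (toℕ<n i)))

  vertex : ∀ {a x} → InBranch depth a x → Fin n
  vertex b = fromℕ< (in-range b)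

  toℕ-vertex : ∀ {a x} (b : InBranch depth a x) → toℕ (vertex b) ≡ x
  toℕ-vertex b = toℕ-fromℕ< (in-range b)

  branch-vertex : ∀ {i : Fin t} {x} (b : InBranch depth (toℕ i) x) → branch (vertex b) ≡ just i
  branch-vertex b = branch≡just⇐ (vertex b) (trans (cong (label depth) (toℕ-vertex b)) (labelled b))

  inBranch-fin : ∀ w {i} → branch w ≡ just i → InBranch depth (toℕ i) (toℕ w)
  inBranch-fin w bw = inBranch (toℕ<n w) (branch≡just⇒ w bw)

  toℕ≤depth : (i : Fin t) → toℕ i ≤ depth
  toℕ≤depth i = <⇒≤ (≤-trans (toℕ<n i) (n≤1+n t))

  walk⇒path : ∀ i {x y} → BranchWalk depth (toℕ i) x y → InBranch depth (toℕ i) y →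
              ∀ {u v : Fin n} → toℕ u ≡ x → toℕ v ≡ y → PathIn G (λ w → branch w ≡ just i) u v
  walk⇒path i ε by {u} {v} refl v≡u rewrite toℕ-injective {i = v} {j = u} v≡u =
    here (branch≡just⇐ u (labelled by))
  walk⇒path i ((bx , bz , x~z) ◅ rest) by {u} refl v≡ =
    step (branch≡just⇐ u (labelled bx)) (subst (λ z → adjacent depth (toℕ u) z ≡ true) (sym (toℕ-vertex bz)) x~z)
         (walk⇒path i rest by {vertex bz} (toℕ-vertex bz) v≡)

  kMinor : KMinor G t
  kMinor = record
    { branch    = branch
    ; nonempty  = λ i → vertex (root-inBranch depth (toℕ≤depth i)) , branch-vertex (root-inBranch depth (toℕ≤depth i))
    ; connected = λ i u v bu bv →
        walk⇒path i (walkToRoot depth (inBranch-fin u bu) ◅◅ reverse BranchStep-sym (walkToRoot depth (inBranch-fin v bv)))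
                  (inBranch-fin v bv) refl refl
    ; joined    = joined
    }
    where
      joined : ∀ i j → i ≢ j → ∃ λ u → ∃ λ v →
               branch u ≡ just i × branch v ≡ just j × adjacent depth (toℕ u) (toℕ v) ≡ true
      joined i j i≢j with labelsAdjacent depth (toℕ≤depth i) (toℕ≤depth j) (i≢j ∘ toℕ-injective)
      ... | _ , _ , bu , bv , u~v = vertex bu , vertex bv , branch-vertex bu , branch-vertex bv
                                  , subst₂ (λ p q → adjacent depth p q ≡ true)
                                           (sym (toℕ-vertex bu)) (sym (toℕ-vertex bv)) u~v

  degree-≤3 : ∀ v → degree G v ≤ 3
  degree-≤3 v = length-≤-by-injection _≟_ toℕ (Unique-filterᵇ (adj G v) (Unique.allFin⁺ n))
                  (λ _ _ → toℕ-injective) neighbour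
    where
      a = toℕ v
      neighbour : ∀ {w} → w ∈ filterᵇ (adj G v) (allFin n) →
                  toℕ w ∈ suc a ∷ pred a ∷ fromMaybe 0 (partner depth a) ∷ []
      neighbour w∈ with adjacency depth (proj₂ (∈-filterᵇ⁻ (adj G v) {xs = allFin n} w∈))
      ... | spine w≡1+a  = here w≡1+a
      ... | spine˘ a≡1+w = there (here (sym (cong pred a≡1+w)))
      ... | chord pa     = there (there (here (cong (fromMaybe 0) (sym pa))))

  6≤n : 6 ≤ n
  6≤n = subst (6 ≤_) (sym (size-suc t)) (*-monoˡ-≤ 6 (m^n>0 3 t))

  small : Fin 6 → Fin n
  small k = inject≤ k 6≤n

  small-injective : ∀ {k l} → small k ≡ small l → k ≡ l
  small-injective = inject≤-injective 6≤n 6≤n _ _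

  degree-small1 : 3 ≤ degree G (small (# 1))
  degree-small1 = length-≤-by-injection _≟ᶠ_ id distinct (λ _ _ eq → eq) neighbour
    where
      distinct : Unique (small (# 0) ∷ small (# 2) ∷ small (# 4) ∷ [])
      distinct = ((λ ()) ∘ small-injective ∷ (λ ()) ∘ small-injective ∷ [])
               ∷ ((λ ()) ∘ small-injective ∷ []) ∷ [] ∷ []
      small-adjacent : ∀ k l → adjacent depth (toℕ k) (toℕ l) ≡ true → adj G (small k) (small l) ≡ true
      small-adjacent k l =
        subst₂ (λ p q → adjacent depth p q ≡ true) (sym (toℕ-inject≤ k 6≤n)) (sym (toℕ-inject≤ l 6≤n))
      neighbour : ∀ {w} → w ∈ small (# 0) ∷ small (# 2) ∷ small (# 4) ∷ [] →
                  w ∈ filterᵇ (adj G (small (# 1))) (allFin n)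
      neighbour (here refl)                 = ∈-filterᵇ⁺ _ (∈-allFin _) (small-adjacent (# 1) (# 0) refl)
      neighbour (there (here refl))         = ∈-filterᵇ⁺ _ (∈-allFin _) (small-adjacent (# 1) (# 2) refl)
      neighbour (there (there (here refl))) = ∈-filterᵇ⁺ _ (∈-allFin _) (small-adjacent (# 1) (# 4) refl)

  maxDegree : MaxDegree G 3
  maxDegree = degree-≤3 , small (# 1) , ≤-antisym (degree-≤3 (small (# 1))) degree-small1

  edgeRank : Fin n × Fin n → ℕ
  edgeRank (u , v) = if suc (toℕ u) ≡ᵇ toℕ v then 0 else suc (rank depth (toℕ u))

  edgeKey : Fin n × Fin n → ℕ
  edgeKey (u , v) = toℕ u

  edge⇒< : ∀ {u v} → (u , v) ∈ edges G → toℕ u < toℕ v × adjacent depth (toℕ u) (toℕ v) ≡ true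
  edge⇒< {u} {v} e∈
    with ∧-≡-true (proj₂ (∈-filterᵇ⁻ (isEdgeᵇ G) {xs = cartesianProduct (allFin n) (allFin n)} e∈))
  ... | u<v , adj-uv = <ᵇ⇒< (toℕ u) (toℕ v) (≡true⇒T u<v) , adj-uv

  data EdgeKind (u v : Fin n) : Set where
    spineEdge : toℕ v ≡ suc (toℕ u) → edgeRank (u , v) ≡ 0 → EdgeKind u v
    chordEdge : partner depth (toℕ u) ≡ just (toℕ v) → edgeRank (u , v) ≡ suc (rank depth (toℕ u)) → EdgeKind u v

  edgeKind : ∀ {u v} → (u , v) ∈ edges G → EdgeKind u v
  edgeKind {u} {v} e∈
    with suc (toℕ u) ≡ᵇ toℕ v in spine? | adjacency depth {toℕ u} {toℕ v} (proj₂ (edge⇒< e∈))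
  ... | true  | _           = spineEdge (sym (≡ᵇ⇒≡ (suc (toℕ u)) (toℕ v) (≡true⇒T spine?)))
                                        (cong (λ b → if b then 0 else suc (rank depth (toℕ u))) spine?)
  ... | false | spine v≡1+u = ⊥-elim (false≢true (trans (sym spine?)
                                (subst (λ z → (suc (toℕ u) ≡ᵇ z) ≡ true) (sym v≡1+u) (≡ᵇ-refl (toℕ u)))))
    where false≢true : false ≢ true
          false≢true ()
  ... | false | spine˘ u≡1+v = ⊥-elim (<-asym (proj₁ (edge⇒< e∈)) (subst (toℕ v <_) (sym u≡1+v) (n<1+n (toℕ v))))
  ... | false | chord pu    = chordEdge pu (cong (λ b → if b then 0 else suc (rank depth (toℕ u))) spine?)

  lowEnd : ℕ → ℕ
  lowEnd e = maybe (e ⊓_) e (partner depth e)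

  touches⇒lowEnd : ∀ {c d e} → partner depth c ≡ just d → c < d → Touches c d e → c ≡ lowEnd e
  touches⇒lowEnd {c} {d} pc c<d (inj₁ refl) rewrite pc = sym (m≤n⇒m⊓n≡m (<⇒≤ c<d))
  touches⇒lowEnd {c} {d} pc c<d (inj₂ refl) rewrite partner-sym depth pc = sym (m≥n⇒m⊓n≡n (<⇒≤ c<d))

  fewLaterCrossings : ∀ {x} → x ∈ edges G → FewLaterNeighbours (edges G) (crossᵇ D) edgeRank edgeKey 2 x
  fewLaterCrossings {u , v} x∈ with edgeKind x∈
  ... | spineEdge v≡1+u _ =
    [] , z≤n , (λ (_ , cr , _) → ⊥-elim (uncrossed cr)) , (λ (_ , cr , _) → ⊥-elim (uncrossed cr))
    where
      uncrossed : ∀ {c d} → crossᵇ D (u , v) (c , d) ≢ true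
      uncrossed {c} {d} cr with crossesᵇ⇒between (toℕ c) (toℕ d) cr (proj₁ (edge⇒< x∈))
      ... | inj₁ (l , r) = <-irrefl refl (<-≤-trans l (≤-pred (subst (toℕ c <_) v≡1+u r)))
      ... | inj₂ (l , r) = <-irrefl refl (<-≤-trans l (≤-pred (subst (toℕ d <_) v≡1+u r)))
  ... | chordEdge pu rank-uv with highCrossers depth pu (proj₁ (edge⇒< x∈))
  ...   | e₁ , e₂ , meet = lowEnd e₁ ∷ lowEnd e₂ ∷ [] , ≤-refl , into , injective
    where
      later⇒chord : ∀ {c d} → LaterNeighbour (edges G) (crossᵇ D) edgeRank (u , v) (c , d) →
                    partner depth (toℕ c) ≡ just (toℕ d) × toℕ c < toℕ d ×
                    rank depth (toℕ u) ≤ rank depth (toℕ c)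
      later⇒chord (y∈ , _ , rk) with edgeKind y∈
      later⇒chord (y∈ , _ , rk) | spineEdge _ rank-cd with subst₂ _≤_ rank-uv rank-cd rk
      ... | ()
      later⇒chord (y∈ , _ , rk) | chordEdge pc rank-cd =
        pc , proj₁ (edge⇒< y∈) , ≤-pred (subst₂ _≤_ rank-uv rank-cd rk)
      into : ∀ {y} → LaterNeighbour (edges G) (crossᵇ D) edgeRank (u , v) y →
             edgeKey y ∈ lowEnd e₁ ∷ lowEnd e₂ ∷ []
      into {c , d} later@(_ , cr , _) with later⇒chord later
      ... | pc , c<d , rk with meet pc c<d cr rk
      ...   | inj₁ t = here (touches⇒lowEnd pc c<d t)
      ...   | inj₂ t = there (here (touches⇒lowEnd pc c<d t))
      injective : ∀ {y z} → LaterNeighbour (edges G) (crossᵇ D) edgeRank (u , v) y →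
                  LaterNeighbour (edges G) (crossᵇ D) edgeRank (u , v) z → edgeKey y ≡ edgeKey z → y ≡ z
      injective {c , d} {c′ , d′} ly lz c≡c′ with later⇒chord ly | later⇒chord lz
      ... | pc , _ | pc′ , _ =
        cong₂ _,_ (toℕ-injective c≡c′)
                  (toℕ-injective (just-injective (trans (sym pc) (trans (cong (partner depth) c≡c′) pc′))))

  crossing-2-degenerate : CrossingGraph2Degenerate G D
  crossing-2-degenerate = degenerate-byRank (edges G) (crossᵇ D) edgeRank edgeKey 2
    (Unique-filterᵇ (isEdgeᵇ G) (Unique.cartesianProduct⁺ (Unique.allFin⁺ n) (Unique.allFin⁺ n))) fewLaterCrossings

theorem19 : (t : ℕ) → Σ ℕ λ n → Σ (SimpleGraph n) λ G → Σ (CircularDrawing n) λ D →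
    KMinor G t × MaxDegree G 3 × CrossingGraph2Degenerate G D
theorem19 t = n , G , D , kMinor , maxDegree , crossing-2-degenerate
  where open Construction t
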